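{- Let $R^{(-1,-)}(x,u)$ (resp. $R^{(0,-)}(x,u)$) be the generating function, with respect to size ($x$) and number of diameters ($u$), of rooted wheels fixed by the reflection $(-1,-)$ (resp. $(0,-)$). Then the generating function $R^-(x,u)$ of reflection-wheels satisfies $$R^{ - }(x,u)=u\frac{\partial}{\partial u}\left(R^{(-1,-)}(x,u)+R^{(0,-)}(x,u)\right).$$
   Context: For $k\geq 1$, a wheel-sequence of length $2k$ is a sequence $(a_1,\ldots,a_{2k})$ of nonnegative integers such that for every $1\le i\le 2k$ (indices mod $2k$), $a_i$ and $a_{i+k}$ are not both $0$, and $a_i$ and $a_{i+1}$ are not both $0$; its size is $\sum a_i$. A rooted wheel with $k$ diameters is a wheel-sequence of length $2k$. For $l\in\mathbf{Z}_{2k}$, the reflection $(l,-)$ acts by $(l,-)\cdot(a_1,\ldots,a_{2k})=(a_{1+l},a_l,\ldots,a_1,a_{2k},\ldots,a_{2+l})$. A reflection-wheel is a pair consisting of a wheel-sequence $s$ of length $2k$ and an element $(l,-)$, $l\in\mathbf{Z}_{2k}$, fixing $s$; $R^-(x,u)$ counts them by size and number of diameters $k$. -}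

module Defs where

open import Data.Nat using (ℕ; zero; suc; _+_; _*_; _∸_; _≡ᵇ_)
open import Data.Nat.DivMod using (_%_; m%n<n)
open import Data.Bool using (Bool; true; false; _∧_; not; T)
open import Data.Fin using (Fin; toℕ; fromℕ<)
open import Data.Vec using (Vec; lookup; tabulate; allFin; foldr)
open import Data.Vec using () renaming (sum to vsum)
open import Data.Product using (Σ; _×_)
open import Relation.Binary.PropositionalEquality using (_≡_)

-- Throughout, the number of diameters is k = suc j (so k ≥ 1) and the
-- sequence length is len j = 2k.  Positions are 0-indexed and read mod 2k:
-- 0-indexed position p corresponds to the paper's index p+1.

len : ℕ → ℕ
len j = 2 * suc j

at : (j : ℕ) → Vec ℕ (len j) → ℕ → ℕ
at j s p = lookup s (fromℕ< (m%n<n p (len j)))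

isZero : ℕ → Bool
isZero n = n ≡ᵇ 0

allIdx : (j : ℕ) → (Fin (len j) → Bool) → Bool
allIdx j f = foldr _ (λ b acc → b ∧ acc) true (tabulate f)

isWheel : (j : ℕ) → Vec ℕ (len j) → Bool
isWheel j s = allIdx j λ i →
  not (isZero (at j s (toℕ i)) ∧ isZero (at j s (toℕ i + suc j)))
  ∧ not (isZero (at j s (toℕ i)) ∧ isZero (at j s (toℕ i + 1)))

-- reflection (l,-): paper's (a_{1+l}, a_l, ..., a_{2+l}), i.e. the i-th entry
-- (1-indexed) is a_{l+2-i}; 0-indexed: entry j' is a'_{(l - j') mod 2k}.
reflect : (j : ℕ) → ℕ → Vec ℕ (len j) → Vec ℕ (len j)
reflect j l s = tabulate λ p → at j s (l + (len j ∸ toℕ p))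

WheelSeq : (j n : ℕ) → Set
WheelSeq j n = Σ (Vec ℕ (len j)) λ s → T (isWheel j s) × vsum s ≡ n

FixedBy : (j n l : ℕ) → Set
FixedBy j n l = Σ (WheelSeq j n) λ w → reflect j l (Σ.proj₁ w) ≡ Σ.proj₁ w

minusOne : ℕ → ℕ
minusOne j = len j ∸ 1

ReflWheel : (j n : ℕ) → Set
ReflWheel j n = Σ (Fin (len j)) λ l → FixedBy j n (toℕ l)

{-# OPTIONS --safe #-}
-- Rotating a wheel-sequence by c preserves the wheel condition and the size, and it
-- conjugates the reflection (l,-) into (l + 2c,-).  So the wheels fixed by (l,-) are in
-- bijection with those fixed by (0,-) when l is even and with those fixed by (-1,-) when l
-- is odd.  Of the 2k reflections k are even and k are odd, which is the factor k (that is,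
-- u ∂/∂u) in front of the two fixed-point counts.
module Submission where

open import Defs
open import Data.Nat using (ℕ; suc; _*_; _+_; _∸_; pred; NonZero)
open import Data.Nat.Properties
  using (+-assoc; +-comm; +-identityʳ; *-comm; m∸n+n≡m; <⇒≤; suc-pred; ≡-irrelevant; _≟_;
         +-commutativeSemigroup; +-0-commutativeMonoid)
open import Data.Nat.DivMod
  using (_%_; _mod_; m%n<n; m<n⇒m%n≡m; m%n%n≡m%n; [m+n]%n≡m%n; %-distribˡ-+; %-remove-+ʳ)
open import Data.Nat.Divisibility using (_∣_; m∣m*n; ∣n⇒∣m*n)
open import Data.Nat.Tactic.RingSolver using (solve-∀)
open import Data.Fin using (Fin; toℕ; combine; cast) renaming (suc to fsuc)
open import Data.Fin.Patterns using (0F; 1F)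
open import Data.Fin.Properties
  using (toℕ-injective; toℕ<n; toℕ-fromℕ<; fromℕ<-cong; toℕ-cast; cast-involutive; toℕ-combine;
         *↔×; +↔⊎)
open import Data.Fin.Permutation using (Permutation; permutation)
open import Data.Vec using (Vec; lookup; tabulate; foldr) renaming (sum to vsum)
open import Data.Vec.Properties using (lookup∘tabulate; tabulate∘lookup; tabulate-cong; ≡-dec)
open import Data.Bool using (Bool; true; _∧_; not; T)
open import Data.Bool.Properties using (T-∧; T-irrelevant)
open import Data.Unit using (tt)
open import Data.Product using (Σ; _×_; _,_; proj₁; proj₂)
open import Data.Product.Algebra using (Σ-assoc)
open import Data.Product.Function.Dependent.Propositional using (Σ-↔)
open import Data.Product.Function.NonDependent.Propositional using (_×-↔_)
open import Data.Sum using (_⊎_; inj₁; inj₂; [_,_])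
open import Data.Sum.Algebra using (⊎-comm)
open import Data.Sum.Function.Propositional using (_⊎-↔_)
open import Function.Base using (_∘_)
open import Function.Bundles using (_↔_; _⇔_; Inverse; Equivalence; mk↔ₛ′; mk⇔)
open import Function.Properties.Inverse using (↔-refl; ↔-sym; ↔-trans)
open import Function.Related.Propositional using (bijection; module EquationalReasoning)
open import Axiom.UniquenessOfIdentityProofs using (module Decidable⇒UIP)
open import Relation.Binary.PropositionalEquality
  using (_≡_; refl; sym; trans; cong; cong₂; subst; module ≡-Reasoning)
import Algebra.Properties.CommutativeMonoid.Sum as CommutativeMonoidSum
import Algebra.Properties.CommutativeSemigroup as CommutativeSemigroupProperties

open CommutativeMonoidSum +-0-commutativeMonoid using (sum; sum-permute)
open CommutativeSemigroupProperties +-commutativeSemigroup using (xy∙z≈xz∙y)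

vsum-tabulate : ∀ {n} (f : Fin n → ℕ) → vsum (tabulate f) ≡ sum f
vsum-tabulate {0}     f = refl
vsum-tabulate {suc n} f = cong (f 0F +_) (vsum-tabulate (f ∘ fsuc))

module Modular (L : ℕ) .{{_ : NonZero L}} where

  %-cong-+ʳ : ∀ x y z → x % L ≡ y % L → (x + z) % L ≡ (y + z) % L
  %-cong-+ʳ x y z eq = begin
    (x + z) % L          ≡⟨ %-distribˡ-+ x z L ⟩
    (x % L + z % L) % L  ≡⟨ cong (λ t → (t + z % L) % L) eq ⟩
    (y % L + z % L) % L  ≡⟨ %-distribˡ-+ y z L ⟨
    (y + z) % L          ∎
    where open ≡-Reasoning

  [m%n+k]%n≡[m+k]%n : ∀ x z → (x % L + z) % L ≡ (x + z) % L
  [m%n+k]%n≡[m+k]%n x z = %-cong-+ʳ (x % L) x z (m%n%n≡m%n x L)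

  neg : ℕ → ℕ
  neg c = pred L * c

  ∣c+neg[c] : ∀ c → L ∣ c + neg c
  ∣c+neg[c] c = subst (L ∣_) (cong (_* c) (sym (suc-pred L))) (m∣m*n c)

  ∣neg[c]+c : ∀ c → L ∣ neg c + c
  ∣neg[c]+c c = subst (L ∣_) (+-comm c (neg c)) (∣c+neg[c] c)

  %-cancelʳ-+ : ∀ x y z → (x + z) % L ≡ (y + z) % L → x % L ≡ y % L
  %-cancelʳ-+ x y z eq = begin
    x % L                  ≡⟨ %-remove-+ʳ x (∣c+neg[c] z) ⟨
    (x + (z + neg z)) % L  ≡⟨ cong (_% L) (+-assoc x z (neg z)) ⟨
    (x + z + neg z) % L    ≡⟨ %-cong-+ʳ (x + z) (y + z) (neg z) eq ⟩
    (y + z + neg z) % L    ≡⟨ cong (_% L) (+-assoc y z (neg z)) ⟩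
    (y + (z + neg z)) % L  ≡⟨ %-remove-+ʳ y (∣c+neg[c] z) ⟩
    y % L                  ∎
    where open ≡-Reasoning

  toℕ-mod : ∀ x → toℕ (x mod L) ≡ x % L
  toℕ-mod x = toℕ-fromℕ< (m%n<n x L)

  mod-cong : ∀ x y → x % L ≡ y % L → x mod L ≡ y mod L
  mod-cong x y eq = fromℕ<-cong _ _ eq (m%n<n x L) (m%n<n y L)

  toℕ-%-injective : {p q : Fin L} → toℕ p % L ≡ toℕ q % L → p ≡ q
  toℕ-%-injective {p} {q} eq = toℕ-injective (begin
    toℕ p      ≡⟨ m<n⇒m%n≡m (toℕ<n p) ⟨
    toℕ p % L  ≡⟨ eq ⟩
    toℕ q % L  ≡⟨ m<n⇒m%n≡m (toℕ<n q) ⟩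
    toℕ q      ∎)
    where open ≡-Reasoning

module Cyclic (L : ℕ) .{{_ : NonZero L}} where
  open Modular L

  shift : ℕ → Fin L → Fin L
  shift c p = (toℕ p + c) mod L

  -- The index l − p mod L: reflect j l s is definitionally tabulate (lookup s ∘ mirror l).
  mirror : ℕ → Fin L → Fin L
  mirror l p = (l + (L ∸ toℕ p)) mod L

  toℕ-shift-% : ∀ c (p : Fin L) → toℕ (shift c p) % L ≡ (toℕ p + c) % L
  toℕ-shift-% c p = trans (cong (_% L) (toℕ-mod (toℕ p + c))) (m%n%n≡m%n (toℕ p + c) L)

  shift-mod : ∀ c x → shift c (x mod L) ≡ (x + c) mod L
  shift-mod c x = mod-cong (toℕ (x mod L) + c) (x + c)
    (trans (cong (λ t → (t + c) % L) (toℕ-mod x)) ([m%n+k]%n≡[m+k]%n x c))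

  shift-shift : ∀ a b (p : Fin L) → L ∣ b + a → shift a (shift b p) ≡ p
  shift-shift a b p L∣b+a = toℕ-%-injective (begin
    toℕ (shift a (shift b p)) % L  ≡⟨ toℕ-shift-% a (shift b p) ⟩
    (toℕ (shift b p) + a) % L      ≡⟨ cong (λ t → (t + a) % L) (toℕ-mod (toℕ p + b)) ⟩
    ((toℕ p + b) % L + a) % L      ≡⟨ [m%n+k]%n≡[m+k]%n (toℕ p + b) a ⟩
    (toℕ p + b + a) % L            ≡⟨ cong (_% L) (+-assoc (toℕ p) b a) ⟩
    (toℕ p + (b + a)) % L          ≡⟨ %-remove-+ʳ (toℕ p) L∣b+a ⟩
    toℕ p % L                      ∎)
    where open ≡-Reasoning

  shiftPermutation : ℕ → Permutation L L
  shiftPermutation c = permutation (shift c) (shift (neg c))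
    (λ p → shift-shift c (neg c) p (∣neg[c]+c c)) (λ p → shift-shift (neg c) c p (∣c+neg[c] c))

  mirror-+ : ∀ l (p : Fin L) → (toℕ (mirror l p) + toℕ p) % L ≡ l % L
  mirror-+ l p = begin
    (toℕ (mirror l p) + toℕ p) % L       ≡⟨ cong (λ t → (t + toℕ p) % L) (toℕ-mod (l + (L ∸ toℕ p))) ⟩
    ((l + (L ∸ toℕ p)) % L + toℕ p) % L  ≡⟨ [m%n+k]%n≡[m+k]%n (l + (L ∸ toℕ p)) (toℕ p) ⟩
    (l + (L ∸ toℕ p) + toℕ p) % L        ≡⟨ cong (_% L) (+-assoc l (L ∸ toℕ p) (toℕ p)) ⟩
    (l + (L ∸ toℕ p + toℕ p)) % L        ≡⟨ cong (λ t → (l + t) % L) (m∸n+n≡m (<⇒≤ (toℕ<n p))) ⟩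
    (l + L) % L                          ≡⟨ [m+n]%n≡m%n l L ⟩
    l % L                                ∎
    where open ≡-Reasoning

  mirror-unique : ∀ l {p q : Fin L} → (toℕ q + toℕ p) % L ≡ l % L → q ≡ mirror l p
  mirror-unique l {p} {q} eq =
    toℕ-%-injective (%-cancelʳ-+ (toℕ q) (toℕ (mirror l p)) (toℕ p) (trans eq (sym (mirror-+ l p))))

  shift-mirror : ∀ {l l'} c (p : Fin L) → l % L ≡ (l' + 2 * c) % L →
                 shift c (mirror l' p) ≡ mirror l (shift c p)
  shift-mirror {l} {l'} c p eq = mirror-unique l (begin
    (toℕ (shift c m) + toℕ (shift c p)) % L  ≡⟨ cong₂ (λ a b → (a + b) % L)
                                                       (toℕ-mod (toℕ m + c)) (toℕ-mod (toℕ p + c)) ⟩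
    ((toℕ m + c) % L + (toℕ p + c) % L) % L  ≡⟨ %-distribˡ-+ (toℕ m + c) (toℕ p + c) L ⟨
    (toℕ m + c + (toℕ p + c)) % L            ≡⟨ cong (_% L) (regroup (toℕ m) (toℕ p) c) ⟩
    (toℕ m + toℕ p + 2 * c) % L              ≡⟨ %-cong-+ʳ (toℕ m + toℕ p) l' (2 * c) (mirror-+ l' p) ⟩
    (l' + 2 * c) % L                         ≡⟨ eq ⟨
    l % L                                    ∎)
    where
    open ≡-Reasoning
    m : Fin L
    m = mirror l' p
    regroup : ∀ x y z → x + z + (y + z) ≡ x + y + 2 * z
    regroup = solve-∀

  rotate : ∀ {A : Set} → ℕ → Vec A L → Vec A L
  rotate c s = tabulate (lookup s ∘ shift c)

  rotate-rotate : ∀ {A : Set} a b (s : Vec A L) → L ∣ a + b → rotate a (rotate b s) ≡ s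
  rotate-rotate a b s L∣a+b = trans
    (tabulate-cong λ p → trans (lookup∘tabulate (lookup s ∘ shift b) (shift a p))
                               (cong (lookup s) (shift-shift b a p L∣a+b)))
    (tabulate∘lookup s)

  sum-rotate : ∀ c (s : Vec ℕ L) → vsum (rotate c s) ≡ vsum s
  sum-rotate c s = begin
    vsum (rotate c s)           ≡⟨ vsum-tabulate (lookup s ∘ shift c) ⟩
    sum (lookup s ∘ shift c)    ≡⟨ sum-permute (lookup s) (shiftPermutation c) ⟨
    sum (lookup s)              ≡⟨ vsum-tabulate (lookup s) ⟨
    vsum (tabulate (lookup s))  ≡⟨ cong vsum (tabulate∘lookup s) ⟩
    vsum s                      ∎
    where open ≡-Reasoning

all : ∀ {n} → (Fin n → Bool) → Bool
all f = foldr (λ _ → Bool) _∧_ true (tabulate f)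

T-all : ∀ {n} (f : Fin n → Bool) → T (all f) ⇔ (∀ i → T (f i))
T-all f = mk⇔ (to f) (from f)
  where
  to : ∀ {n} (f : Fin n → Bool) → T (all f) → ∀ i → T (f i)
  to f t 0F       = proj₁ (Equivalence.to T-∧ t)
  to f t (fsuc i) = to (f ∘ fsuc) (proj₂ (Equivalence.to T-∧ t)) i
  from : ∀ {n} (f : Fin n → Bool) → (∀ i → T (f i)) → T (all f)
  from {0}     f t = tt
  from {suc n} f t = Equivalence.from T-∧ (t 0F , from (f ∘ fsuc) (t ∘ fsuc))

notBothZero : ℕ → ℕ → Bool
notBothZero u v = not (isZero u ∧ isZero v)

wheelAt : (ℕ → ℕ) → ℕ → ℕ → Bool
wheelAt a k x = notBothZero (a x) (a (x + k)) ∧ notBothZero (a x) (a (x + 1))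

wheelAt-cong : ∀ (a b : ℕ → ℕ) k x y → a x ≡ b y → a (x + k) ≡ b (y + k) → a (x + 1) ≡ b (y + 1) →
               wheelAt a k x ≡ wheelAt b k y
wheelAt-cong a b k x y e₀ eₖ e₁ = cong₂ _∧_ (cong₂ notBothZero e₀ eₖ) (cong₂ notBothZero e₀ e₁)

module Wheels (j : ℕ) where
  open Modular (len j)
  open Cyclic (len j)

  at-cong : ∀ (s : Vec ℕ (len j)) x y → x % len j ≡ y % len j → at j s x ≡ at j s y
  at-cong s x y eq = cong (lookup s) (mod-cong x y eq)

  at-rotate : ∀ c (s : Vec ℕ (len j)) x y → (x + c) % len j ≡ y % len j →
              at j (rotate c s) x ≡ at j s y
  at-rotate c s x y eq = trans (lookup∘tabulate (lookup s ∘ shift c) (x mod len j))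
                               (trans (cong (lookup s) (shift-mod c x)) (at-cong s (x + c) y eq))

  wheelAt-rotate : ∀ c (s : Vec ℕ (len j)) (i : Fin (len j)) →
                   wheelAt (at j (rotate c s)) (suc j) (toℕ i)
                     ≡ wheelAt (at j s) (suc j) (toℕ (shift c i))
  wheelAt-rotate c s i = wheelAt-cong (at j (rotate c s)) (at j s) (suc j) (toℕ i) (toℕ (shift c i))
    (at-rotate c s (toℕ i) (toℕ (shift c i)) (sym (toℕ-shift-% c i)))
    (at-rotate-+ (suc j)) (at-rotate-+ 1)
    where
    at-rotate-+ : ∀ d → at j (rotate c s) (toℕ i + d) ≡ at j s (toℕ (shift c i) + d)
    at-rotate-+ d = at-rotate c s (toℕ i + d) (toℕ (shift c i) + d)
      (trans (cong (_% len j) (xy∙z≈xz∙y (toℕ i) d c))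
             (%-cong-+ʳ (toℕ i + c) (toℕ (shift c i)) d (sym (toℕ-shift-% c i))))

  T-isWheel : ∀ (s : Vec ℕ (len j)) →
              T (isWheel j s) ⇔ (∀ (i : Fin (len j)) → T (wheelAt (at j s) (suc j) (toℕ i)))
  T-isWheel s = T-all (λ i → wheelAt (at j s) (suc j) (toℕ i))

  isWheel-rotate : ∀ c (s : Vec ℕ (len j)) → T (isWheel j s) → T (isWheel j (rotate c s))
  isWheel-rotate c s wheel = Equivalence.from (T-isWheel (rotate c s)) λ i →
    subst T (sym (wheelAt-rotate c s i)) (Equivalence.to (T-isWheel s) wheel (shift c i))

  reflect-rotate : ∀ {l l'} c (s : Vec ℕ (len j)) → l % len j ≡ (l' + 2 * c) % len j →
                   reflect j l' (rotate c s) ≡ rotate c (reflect j l s)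
  reflect-rotate {l} {l'} c s eq = tabulate-cong λ p → begin
    lookup (rotate c s) (mirror l' p)    ≡⟨ lookup∘tabulate (lookup s ∘ shift c) (mirror l' p) ⟩
    lookup s (shift c (mirror l' p))     ≡⟨ cong (lookup s) (shift-mirror {l} {l'} c p eq) ⟩
    lookup s (mirror l (shift c p))      ≡⟨ lookup∘tabulate (lookup s ∘ mirror l) (shift c p) ⟨
    lookup (reflect j l s) (shift c p)   ∎
    where open ≡-Reasoning

  module _ {n : ℕ} where

    FixedBy-≡ : ∀ {l} {a b : FixedBy j n l} → proj₁ (proj₁ a) ≡ proj₁ (proj₁ b) → a ≡ b
    FixedBy-≡ {a = (s , wheel , size) , fixed} {b = (.s , wheel′ , size′) , fixed′} refl
      with T-irrelevant wheel wheel′ | ≡-irrelevant size size′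
         | Decidable⇒UIP.≡-irrelevant (≡-dec _≟_) fixed fixed′
    ... | refl | refl | refl = refl

    rotateFixed : ∀ {l l'} c → l % len j ≡ (l' + 2 * c) % len j → FixedBy j n l → FixedBy j n l'
    rotateFixed {l} {l'} c eq ((s , wheel , size) , fixed) =
      (rotate c s , isWheel-rotate c s wheel , trans (sum-rotate c s) size) ,
      trans (reflect-rotate {l} {l'} c s eq) (cong (rotate c) fixed)

    FixedBy-rotate-↔ : ∀ l l' c → l % len j ≡ (l' + 2 * c) % len j → FixedBy j n l ↔ FixedBy j n l'
    FixedBy-rotate-↔ l l' c eq = mk↔ₛ′ (rotateFixed {l} {l'} c eq) (rotateFixed {l'} {l} (neg c) eq′)
      (λ b → FixedBy-≡ {l'} (rotate-rotate c (neg c) (proj₁ (proj₁ b)) (∣c+neg[c] c)))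
      (λ a → FixedBy-≡ {l} (rotate-rotate (neg c) c (proj₁ (proj₁ a)) (∣neg[c]+c c)))
      where
      eq′ : l' % len j ≡ (l + 2 * neg c) % len j
      eq′ = begin
        l' % len j                          ≡⟨ %-remove-+ʳ l' (∣n⇒∣m*n 2 (∣c+neg[c] c)) ⟨
        (l' + 2 * (c + neg c)) % len j      ≡⟨ cong (_% len j) (distrib l' c (neg c)) ⟩
        (l' + 2 * c + 2 * neg c) % len j    ≡⟨ %-cong-+ʳ (l' + 2 * c) l (2 * neg c) (sym eq) ⟩
        (l + 2 * neg c) % len j             ∎
        where
        open ≡-Reasoning
        distrib : ∀ x y z → x + 2 * (y + z) ≡ x + 2 * y + 2 * z
        distrib = solve-∀

cast↔ : ∀ {m n} → m ≡ n → Fin m ↔ Fin n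
cast↔ eq = mk↔ₛ′ (cast eq) (cast (sym eq)) (cast-involutive eq (sym eq)) (cast-involutive (sym eq) eq)

Σ-Fin2↔⊎ : {P : Fin 2 → Set} → Σ (Fin 2) P ↔ (P 0F ⊎ P 1F)
Σ-Fin2↔⊎ = mk↔ₛ′ (λ { (0F , x) → inj₁ x ; (1F , y) → inj₂ y ; (fsuc (fsuc ()) , _) })
                 [ (0F ,_) , (1F ,_) ]
                 (λ { (inj₁ x) → refl ; (inj₂ y) → refl })
                 (λ { (0F , x) → refl ; (1F , y) → refl ; (fsuc (fsuc ()) , _) })

parity↔ : ∀ k → (Fin k × Fin 2) ↔ Fin (2 * k)
parity↔ k = ↔-trans (↔-sym (*↔× {k} {2})) (cast↔ (*-comm k 2))

toℕ-parity↔ : ∀ {k} (c : Fin k) (b : Fin 2) →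
              toℕ (Inverse.to (parity↔ k) (c , b)) ≡ 2 * toℕ c + toℕ b
toℕ-parity↔ {k} c b = trans (toℕ-cast (*-comm k 2) (combine c b)) (toℕ-combine c b)

module ReflectionWheels (j n : ℕ) where
  open Wheels j

  FixedByRepresentative : Fin 2 → Set
  FixedByRepresentative 0F = FixedBy j n 0
  FixedByRepresentative 1F = FixedBy j n (minusOne j)

  reflectionIndex : Fin (suc j) → Fin 2 → ℕ
  reflectionIndex c b = toℕ (Inverse.to (parity↔ (suc j)) (c , b))

  FixedBy-parity↔ : ∀ c b → FixedBy j n (reflectionIndex c b) ↔ FixedByRepresentative b
  FixedBy-parity↔ c 0F = FixedBy-rotate-↔ (reflectionIndex c 0F) 0 (toℕ c)
    (cong (_% len j) (trans (toℕ-parity↔ c 0F) (+-identityʳ (2 * toℕ c))))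
  FixedBy-parity↔ c 1F = FixedBy-rotate-↔ (reflectionIndex c 1F) (minusOne j) (suc (toℕ c)) (begin
    reflectionIndex c 1F % len j            ≡⟨ cong (_% len j) (toℕ-parity↔ c 1F) ⟩
    (2 * toℕ c + 1) % len j                 ≡⟨ [m+n]%n≡m%n (2 * toℕ c + 1) (len j) ⟨
    (2 * toℕ c + 1 + len j) % len j         ≡⟨ cong (_% len j) (regroup (toℕ c) (minusOne j)) ⟩
    (minusOne j + 2 * suc (toℕ c)) % len j  ∎)
    where
    open ≡-Reasoning
    -- applied with m = minusOne j, for which suc m is definitionally len j
    regroup : ∀ x m → 2 * x + 1 + suc m ≡ m + 2 * suc x
    regroup = solve-∀

  ReflWheel↔ : ReflWheel j n ↔ (Fin (suc j) × (FixedBy j n (minusOne j) ⊎ FixedBy j n 0))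
  ReflWheel↔ = begin
    ReflWheel j n
      ↔⟨ Σ-↔ (parity↔ (suc j)) (λ {(c , b)} → ↔-sym (FixedBy-parity↔ c b)) ⟨
    Σ (Fin (suc j) × Fin 2) (FixedByRepresentative ∘ proj₂)    ↔⟨ Σ-assoc ⟩
    (Fin (suc j) × Σ (Fin 2) FixedByRepresentative)            ↔⟨ ↔-refl ×-↔ Σ-Fin2↔⊎ ⟩
    (Fin (suc j) × (FixedBy j n 0 ⊎ FixedBy j n (minusOne j))) ↔⟨ ↔-refl ×-↔ ⊎-comm _ _ ⟩
    (Fin (suc j) × (FixedBy j n (minusOne j) ⊎ FixedBy j n 0)) ∎
    where open EquationalReasoning {k = bijection}

lemma2 : (j n m₁ m₂ : ℕ) → (FixedBy j n (minusOne j) ↔ Fin m₁) → (FixedBy j n 0 ↔ Fin m₂)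
    → ReflWheel j n ↔ Fin (suc j * (m₁ + m₂))
lemma2 j n m₁ m₂ i₁ i₂ = begin
  ReflWheel j n                                              ↔⟨ ReflectionWheels.ReflWheel↔ j n ⟩
  (Fin (suc j) × (FixedBy j n (minusOne j) ⊎ FixedBy j n 0)) ↔⟨ ↔-refl ×-↔ (i₁ ⊎-↔ i₂) ⟩
  (Fin (suc j) × (Fin m₁ ⊎ Fin m₂))                          ↔⟨ ↔-refl ×-↔ +↔⊎ {m₁} {m₂} ⟨
  (Fin (suc j) × Fin (m₁ + m₂))                              ↔⟨ *↔× {suc j} {m₁ + m₂} ⟨
  Fin (suc j * (m₁ + m₂))                                    ∎
  where open EquationalReasoning {k = bijection}
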